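{- Let $G$ be a string graph over a compressed monoidal signature $T$, and let $H$ be a subgraph of $G$ which is itself a string graph (with the restricted typing). Then $H$ is open in $G$ if and only if $G \setminus H$ (the full subgraph of $G$ on the vertices not in $H$, with restricted typing) is a string graph and the inclusion $G \setminus H \hookrightarrow G$ is boundary-coherent.
   Context: A compressed monoidal signature $T = (O,M,\mathrm{dom},\mathrm{cod})$ consists of sets $O,M$ and functions $\mathrm{dom},\mathrm{cod} : M \rightarrow (O\times\{\mathsf{v},\mathsf{f}\})^*$. The derived compressed typegraph $\mathcal{G}_T$ has vertex set $O \sqcup M$, a self-loop on each $X\in O$, for each $f\in M$ and index $i$ of $\mathrm{dom}(f)$ with $\mathrm{dom}(f)[i]=(X,a)$ an edge $\mathrm{in}^a_{f,i}$ from $X$ to $f$, and for each index $j$ of $\mathrm{cod}(f)$ with $\mathrm{cod}(f)[j]=(X,a)$ an edge $\mathrm{out}^a_{f,j}$ from $f$ to $X$. In a finite directed multigraph with typing morphism to $\mathcal{G}_T$, vertices typed in $O$ are wire-vertices and those typed in $M$ node-vertices; an edge is fixed-arity if its type is tagged $\mathsf{f}$. A string graph is such a typed graph whose typing morphism restricts, at each node-vertex $v$, to a bijection from the fixed-arity edges incident to $v$ onto the fixed-arity edges of $\mathcal{G}_T$ incident to the type of $v$, and in which every wire-vertex has at most one incoming and at most one outgoing edge. An input is a wire-vertex with no incoming edge, an output a wire-vertex with no outgoing edge. A subgraph $H$ of $G$ that is a string graph is open in $G$ if no vertex of $H$ is joined by an edge of $G$ to a wire-vertex not in $H$, and no fixed-arity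 edge of $G$ not in $H$ is incident to a vertex of $H$. A morphism $f : A \rightarrow B$ of string graphs is boundary-coherent if it sends every input of $A$ to an input of $B$ and every output of $A$ to an output of $B$. -}

module Defs where

open import Data.Bool using (Bool; true; false; T)
open import Data.Empty using (⊥)
open import Data.Fin using (Fin)
open import Data.List using (List; length; lookup)
open import Data.Maybe using (Maybe; just; nothing)
open import Data.Nat using (ℕ)
open import Data.Product using (Σ; _×_; _,_; proj₁; proj₂)
open import Data.Sum using (_⊎_; inj₁; inj₂)
open import Data.Unit using (⊤)
open import Function.Bundles using (_↔_)
open import Relation.Nullary using (¬_)
open import Relation.Binary.PropositionalEquality using (_≡_; refl; trans; cong)

-- variable-arity (v) / fixed-arity (f) tags
data Tag : Set where
  v f : Tag

record Signature : Set₁ where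
  field
    O   : Set
    M   : Set
    dom : M → List (O × Tag)
    cod : M → List (O × Tag)

module TypeGraph (Σ𝑇 : Signature) where
  open Signature Σ𝑇

  TVertex : Set
  TVertex = O ⊎ M

  data TEdge : Set where
    loop : O → TEdge
    inT  : (g : M) → Fin (length (dom g)) → TEdge
    outT : (g : M) → Fin (length (cod g)) → TEdge

  tsrc : TEdge → TVertex
  tsrc (loop X)   = inj₁ X
  tsrc (inT g i)  = inj₁ (proj₁ (lookup (dom g) i))
  tsrc (outT g j) = inj₂ g

  ttgt : TEdge → TVertex
  ttgt (loop X)   = inj₁ X
  ttgt (inT g i)  = inj₂ g
  ttgt (outT g j) = inj₁ (proj₁ (lookup (cod g) j))

  tagOf : TEdge → Maybe Tag
  tagOf (loop X)   = nothing
  tagOf (inT g i)  = just (proj₂ (lookup (dom g) i))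
  tagOf (outT g j) = just (proj₂ (lookup (cod g) j))

  FixedT : TEdge → Set
  FixedT e = tagOf e ≡ just f

  IsWireType : TVertex → Set
  IsWireType (inj₁ _) = ⊤
  IsWireType (inj₂ _) = ⊥

module Graphs (Σ𝑇 : Signature) where
  open Signature Σ𝑇
  open TypeGraph Σ𝑇 public

  record TypedGraph : Set₁ where
    field
      V    : Set
      E    : Set
      s    : E → V
      t    : E → V
      τV   : V → TVertex
      τE   : E → TEdge
      τ-s  : ∀ e → τV (s e) ≡ tsrc (τE e)
      τ-t  : ∀ e → τV (t e) ≡ ttgt (τE e)

  Finite : TypedGraph → Set
  Finite G = Σ ℕ (λ n → TypedGraph.V G ↔ Fin n) × Σ ℕ (λ m → TypedGraph.E G ↔ Fin m)

  module _ (G : TypedGraph) where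
    open TypedGraph G

    IsWire : V → Set
    IsWire x = IsWireType (τV x)

    IsNode : V → Set
    IsNode x = Σ M (λ g → τV x ≡ inj₂ g)

    Fixed : E → Set
    Fixed e = FixedT (τE e)

    Incident : E → V → Set
    Incident e x = (s e ≡ x) ⊎ (t e ≡ x)

    TIncident : TEdge → TVertex → Set
    TIncident e x = (tsrc e ≡ x) ⊎ (ttgt e ≡ x)

    LocalBijection : V → Set
    LocalBijection x =
      (∀ e₁ e₂ → Fixed e₁ → Incident e₁ x → Fixed e₂ → Incident e₂ x →
         τE e₁ ≡ τE e₂ → e₁ ≡ e₂)
      × (∀ e′ → FixedT e′ → TIncident e′ (τV x) →
           Σ E (λ e → Fixed e × Incident e x × τE e ≡ e′))

    record IsStringGraph : Set where
      field
        local-bij : ∀ x → IsNode x → LocalBijection x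
        wire-in   : ∀ x → IsWire x → ∀ e₁ e₂ → t e₁ ≡ x → t e₂ ≡ x → e₁ ≡ e₂
        wire-out  : ∀ x → IsWire x → ∀ e₁ e₂ → s e₁ ≡ x → s e₂ ≡ x → e₁ ≡ e₂

    IsInput : V → Set
    IsInput x = IsWire x × (∀ e → ¬ (t e ≡ x))

    IsOutput : V → Set
    IsOutput x = IsWire x × (∀ e → ¬ (s e ≡ x))

  record Morphism (A B : TypedGraph) : Set where
    private
      module A = TypedGraph A
      module B = TypedGraph B
    field
      fV   : A.V → B.V
      fE   : A.E → B.E
      f-s  : ∀ e → B.s (fE e) ≡ fV (A.s e)
      f-t  : ∀ e → B.t (fE e) ≡ fV (A.t e)
      f-τV : ∀ x → B.τV (fV x) ≡ A.τV x
      f-τE : ∀ e → B.τE (fE e) ≡ A.τE e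

  BoundaryCoherent : {A B : TypedGraph} → Morphism A B → Set
  BoundaryCoherent {A} {B} φ =
    (∀ x → IsInput A x → IsInput B (fV x)) × (∀ x → IsOutput A x → IsOutput B (fV x))
    where open Morphism φ

  record Subgraph (G : TypedGraph) : Set where
    open TypedGraph G
    field
      inV    : V → Bool
      inE    : E → Bool
      s-closed : ∀ e → T (inE e) → T (inV (s e))
      t-closed : ∀ e → T (inE e) → T (inV (t e))

  asGraph : {G : TypedGraph} → Subgraph G → TypedGraph
  asGraph {G} H = record
    { V   = Σ V (λ x → T (inV x))
    ; E   = Σ E (λ e → T (inE e))
    ; s   = λ { (e , p) → s e , s-closed e p }
    ; t   = λ { (e , p) → t e , t-closed e p }
    ; τV  = λ x → τV (proj₁ x)
    ; τE  = λ e → τE (proj₁ e)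
    ; τ-s = λ e → τ-s (proj₁ e)
    ; τ-t = λ e → τ-t (proj₁ e)
    }
    where open TypedGraph G
          open Subgraph H

  inclusion : {G : TypedGraph} (H : Subgraph G) → Morphism (asGraph H) G
  inclusion H = record
    { fV = proj₁ ; fE = proj₁
    ; f-s = λ _ → refl ; f-t = λ _ → refl ; f-τV = λ _ → refl ; f-τE = λ _ → refl }

  not : Bool → Bool
  not true = false
  not false = true

  and : Bool → Bool → Bool
  and true b = b
  and false _ = false

  private
    T-and₁ : ∀ a b → T (and a b) → T a
    T-and₁ true  b _ = _
    T-and₁ false b ()

    T-and₂ : ∀ a b → T (and a b) → T b
    T-and₂ true  b p = p
    T-and₂ false b ()

  complement : {G : TypedGraph} → Subgraph G → Subgraph G
  complement {G} H = record
    { inV = λ x → not (inV x)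
    ; inE = λ e → and (not (inV (s e))) (not (inV (t e)))
    ; s-closed = λ e p → T-and₁ (not (inV (s e))) (not (inV (t e))) p
    ; t-closed = λ e p → T-and₂ (not (inV (s e))) (not (inV (t e))) p
    }
    where open TypedGraph G
          open Subgraph H

  Open : {G : TypedGraph} → Subgraph G → Set
  Open {G} H =
    (∀ e → ¬ (T (inV (s e)) × IsWire G (t e) × T (not (inV (t e)))))
    × (∀ e → ¬ (T (inV (t e)) × IsWire G (s e) × T (not (inV (s e)))))
    × (∀ e → T (not (inE e)) → Fixed G e → ¬ (T (inV (s e)) ⊎ T (inV (t e))))
    where open TypedGraph G
          open Subgraph H

module Submission where

-- The three clauses of openness are matched one by one with the right-hand
-- side.
--   * A subgraph K of a string graph G is itself a string graph iff it is
--     fixed-closed: every fixed-arity edge of G at a node-vertex of K lies in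
--     K.  (Injectivity of the local bijections and the wire conditions are
--     always inherited from G; only surjectivity can fail.)
--   * Since H is a string graph it is fixed-closed, and then the third
--     clause of openness (no fixed-arity edge leaves H) is equivalent to
--     fixed-closedness of G ∖ H: every fixed-arity edge has a node-vertex
--     end, which lies either in H or in G ∖ H.
--   * The first (second) clause of openness, no edge from H into a
--     wire-vertex outside H (and dually), is equivalent to the inclusion of
--     G ∖ H preserving inputs (outputs): an edge entering a wire-vertex of
--     G ∖ H from H is exactly what turns an input of G ∖ H into a non-input
--     of G.

open import Data.Bool using (Bool; true; false; T)
open import Data.Bool.Properties using (T-irrelevant)
open import Data.Empty using (⊥-elim)
open import Data.Product using (Σ; _×_; _,_; proj₁; proj₂)
open import Data.Sum using (_⊎_; inj₁; inj₂)
open import Data.Unit using (tt)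
open import Function.Bundles using (_⇔_; mk⇔; Equivalence)
open import Relation.Nullary using (¬_; yes; no)
open import Relation.Nullary.Decidable using (T?)
open import Relation.Binary.PropositionalEquality
  using (_≡_; refl; sym; trans; cong; subst)

open import Defs

member-≡ : {A : Set} (P : A → Bool) {x y : A} → x ≡ y →
           (p : T (P x)) (q : T (P y)) →
           _≡_ {A = Σ A (λ z → T (P z))} (x , p) (y , q)
member-≡ P {x} refl p q = cong (x ,_) (T-irrelevant p q)

module StringSubgraphs (Σ𝑇 : Signature) where
  open Graphs Σ𝑇

  T-not⇒¬T : ∀ b → T (not b) → ¬ T b
  T-not⇒¬T false _ ()

  ¬T⇒T-not : ∀ b → ¬ T b → T (not b)
  ¬T⇒T-not true  ¬b = ¬b tt
  ¬T⇒T-not false _  = tt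

  T-nor-intro : ∀ a b → ¬ T a → ¬ T b → T (and (not a) (not b))
  T-nor-intro true  _     ¬a _  = ¬a tt
  T-nor-intro false true  _  ¬b = ¬b tt
  T-nor-intro false false _  _  = tt

  T-nor-elim : ∀ a b → T (and (not a) (not b)) → ¬ (T a ⊎ T b)
  T-nor-elim false false _ (inj₁ ())
  T-nor-elim false false _ (inj₂ ())

  ¬T-nor : ∀ a b → ¬ T (and (not a) (not b)) → T a ⊎ T b
  ¬T-nor true  _     _ = inj₁ tt
  ¬T-nor false true  _ = inj₂ tt
  ¬T-nor false false ¬n = ⊥-elim (¬n tt)

  module _ {G : TypedGraph} where
    open TypedGraph G

    type-incident : ∀ {e x} → Incident G e x → TIncident G (τE e) (τV x)
    type-incident {e} (inj₁ refl) = inj₁ (sym (τ-s e))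
    type-incident {e} (inj₂ refl) = inj₂ (sym (τ-t e))

    -- Every fixed-arity edge has a node-vertex end: only the in- and
    -- out-edges of 𝒢_T carry a tag, and each of them has a node end.
    node-end : ∀ e → Fixed G e → Σ V (λ n → Incident G e n × IsNode G n)
    node-end e = go (τE e) refl
      where
      go : ∀ te → τE e ≡ te → FixedT te → Σ V (λ n → Incident G e n × IsNode G n)
      go (inT g i)  eq _ = t e , inj₂ refl , g , trans (τ-t e) (cong ttgt eq)
      go (outT g j) eq _ = s e , inj₁ refl , g , trans (τ-s e) (cong tsrc eq)

    module _ (K : Subgraph G) where
      open Subgraph K

      incident-↓ : ∀ {e x} → Incident (asGraph K) e x → Incident G (proj₁ e) (proj₁ x)
      incident-↓ (inj₁ eq) = inj₁ (cong proj₁ eq)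
      incident-↓ (inj₂ eq) = inj₂ (cong proj₁ eq)

      incident-↑ : ∀ {e x} (p : T (inE e)) (q : T (inV x)) →
                   Incident G e x → Incident (asGraph K) (e , p) (x , q)
      incident-↑ _ q (inj₁ eq) = inj₁ (member-≡ inV eq _ q)
      incident-↑ _ q (inj₂ eq) = inj₂ (member-≡ inV eq _ q)

      endpoint-member : ∀ {e x} → T (inE e) → Incident G e x → T (inV x)
      endpoint-member {e} p (inj₁ refl) = s-closed e p
      endpoint-member {e} p (inj₂ refl) = t-closed e p

      FixedClosed : Set
      FixedClosed = ∀ {e x} → T (inV x) → IsNode G x → Fixed G e → Incident G e x → T (inE e)

      module _ (sg : IsStringGraph G) where
        private module SG = IsStringGraph sg

        -- Fixed-closedness supplies exactly the surjectivity of the local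
        -- bijections of K; everything else is inherited from G.
        fixedClosed⇒stringGraph : FixedClosed → IsStringGraph (asGraph K)
        fixedClosed⇒stringGraph closed = record
          { local-bij = λ { (x , px) nd → injective x nd , surjective x px nd }
          ; wire-in   = λ { (x , _) w (e₁ , p₁) (e₂ , p₂) h₁ h₂ →
              member-≡ inE (SG.wire-in x w e₁ e₂ (cong proj₁ h₁) (cong proj₁ h₂)) p₁ p₂ }
          ; wire-out  = λ { (x , _) w (e₁ , p₁) (e₂ , p₂) h₁ h₂ →
              member-≡ inE (SG.wire-out x w e₁ e₂ (cong proj₁ h₁) (cong proj₁ h₂)) p₁ p₂ }
          }
          where
          injective : ∀ x → IsNode G x → ∀ {px} (e₁ e₂ : Σ E (λ e → T (inE e))) →
                      Fixed G (proj₁ e₁) → Incident (asGraph K) e₁ (x , px) →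
                      Fixed G (proj₁ e₂) → Incident (asGraph K) e₂ (x , px) →
                      τE (proj₁ e₁) ≡ τE (proj₁ e₂) → e₁ ≡ e₂
          injective x nd (e₁ , p₁) (e₂ , p₂) f₁ i₁ f₂ i₂ τ≡ =
            member-≡ inE (proj₁ (SG.local-bij x nd) e₁ e₂ f₁ (incident-↓ i₁) f₂ (incident-↓ i₂) τ≡) p₁ p₂

          surjective : ∀ x px → IsNode G x → ∀ e′ → FixedT e′ → TIncident G e′ (τV x) →
                       Σ (Σ E (λ e → T (inE e)))
                         (λ e → Fixed G (proj₁ e) × Incident (asGraph K) e (x , px) × τE (proj₁ e) ≡ e′)
          surjective x px nd e′ fe′ ie′ with proj₂ (SG.local-bij x nd) e′ fe′ ie′
          ... | e , fe , ie , τ≡ = (e , p) , fe , incident-↑ p px ie , τ≡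
            where
            p : T (inE e)
            p = closed px nd fe ie

        -- Conversely the surjectivity of K's local bijection at x produces,
        -- for each fixed-arity edge e at x, an edge of K with the type of
        -- e, which is e itself by injectivity in G.
        stringGraph⇒fixedClosed : IsStringGraph (asGraph K) → FixedClosed
        stringGraph⇒fixedClosed sk {e} {x} px nd fe ie
          with proj₂ (IsStringGraph.local-bij sk (x , px) nd) (τE e) fe (type-incident ie)
        ... | (e₀ , p₀) , f₀ , i₀ , τ≡ =
          subst (λ d → T (inE d)) (proj₁ (SG.local-bij x nd) e₀ e f₀ (incident-↓ i₀) fe ie τ≡) p₀

    module _ (H : Subgraph G) where
      open Subgraph H
      private module C = Subgraph (complement H)

      complement-edge : ∀ {e} → ¬ T (inV (s e)) → ¬ T (inV (t e)) → T (C.inE e)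
      complement-edge {e} = T-nor-intro (inV (s e)) (inV (t e))

      complement-edge-ends : ∀ {e} → T (C.inE e) → ¬ (T (inV (s e)) ⊎ T (inV (t e)))
      complement-edge-ends {e} = T-nor-elim (inV (s e)) (inV (t e))

      non-complement-edge : ∀ {e} → ¬ T (C.inE e) → T (inV (s e)) ⊎ T (inV (t e))
      non-complement-edge {e} = ¬T-nor (inV (s e)) (inV (t e))

      NoEdgeToOuterWire : Set
      NoEdgeToOuterWire = ∀ e → ¬ (T (inV (s e)) × IsWire G (t e) × T (not (inV (t e))))

      NoEdgeFromOuterWire : Set
      NoEdgeFromOuterWire = ∀ e → ¬ (T (inV (t e)) × IsWire G (s e) × T (not (inV (s e))))

      NoFixedEdgeLeaves : Set
      NoFixedEdgeLeaves = ∀ e → T (not (inE e)) → Fixed G e → ¬ (T (inV (s e)) ⊎ T (inV (t e)))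

      InputsPreserved : Set
      InputsPreserved = ∀ x → IsInput (asGraph (complement H)) x → IsInput G (proj₁ x)

      OutputsPreserved : Set
      OutputsPreserved = ∀ x → IsOutput (asGraph (complement H)) x → IsOutput G (proj₁ x)

      noFixedEdgeLeaves⇔ : FixedClosed H → NoFixedEdgeLeaves ⇔ FixedClosed (complement H)
      noFixedEdgeLeaves⇔ closedH = mk⇔ to from
        where
        to : NoFixedEdgeLeaves → FixedClosed (complement H)
        to noLeave {e} px _ fe ie = complement-edge (λ ps → ends (inj₁ ps)) (λ pt → ends (inj₂ pt))
          where
          e∉H : ¬ T (inE e)
          e∉H pe = T-not⇒¬T (inV _) px (endpoint-member H pe ie)
          ends : ¬ (T (inV (s e)) ⊎ T (inV (t e)))
          ends = noLeave e (¬T⇒T-not (inE e) e∉H) fe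

        from : FixedClosed (complement H) → NoFixedEdgeLeaves
        from closedC e e∉H fe ends with node-end e fe
        ... | n , ie , nd with T? (inV n)
        ...   | yes n∈H = T-not⇒¬T (inE e) e∉H (closedH n∈H nd fe ie)
        ...   | no  n∉H = complement-edge-ends (closedC (¬T⇒T-not (inV n) n∉H) nd fe ie) ends

      module _ (sg : IsStringGraph G) where
        private module SG = IsStringGraph sg

        -- An edge from H into a wire-vertex w outside H is the unique
        -- incoming edge of w, so w is an input of G ∖ H but not of G.
        noEdgeToOuterWire⇔ : NoEdgeToOuterWire ⇔ InputsPreserved
        noEdgeToOuterWire⇔ = mk⇔ to from
          where
          to : NoEdgeToOuterWire → InputsPreserved
          to noEdge (x , px) (w , noInC) = w , noIn
            where
            noIn : ∀ e → ¬ t e ≡ x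
            noIn e refl with T? (C.inE e)
            ... | yes pe = noInC (e , pe) (member-≡ C.inV refl _ px)
            ... | no  pe with non-complement-edge pe
            ...   | inj₁ ps = noEdge e (ps , w , px)
            ...   | inj₂ pt = T-not⇒¬T (inV (t e)) px pt

          from : InputsPreserved → NoEdgeToOuterWire
          from preserved e (ps , w , pt) = proj₂ (preserved (t e , pt) (w , noInC)) e refl
            where
            noInC : ∀ e′ → ¬ TypedGraph.t (asGraph (complement H)) e′ ≡ (t e , pt)
            noInC (e′ , pe′) eq = complement-edge-ends
              (subst (λ d → T (C.inE d)) (SG.wire-in (t e) w e′ e (cong proj₁ eq) refl) pe′) (inj₁ ps)

        -- Dually, an edge into H from a wire-vertex outside H is what makes
        -- an output of G ∖ H fail to be an output of G.
        noEdgeFromOuterWire⇔ : NoEdgeFromOuterWire ⇔ OutputsPreserved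
        noEdgeFromOuterWire⇔ = mk⇔ to from
          where
          to : NoEdgeFromOuterWire → OutputsPreserved
          to noEdge (x , px) (w , noOutC) = w , noOut
            where
            noOut : ∀ e → ¬ s e ≡ x
            noOut e refl with T? (C.inE e)
            ... | yes pe = noOutC (e , pe) (member-≡ C.inV refl _ px)
            ... | no  pe with non-complement-edge pe
            ...   | inj₁ ps = T-not⇒¬T (inV (s e)) px ps
            ...   | inj₂ pt = noEdge e (pt , w , px)

          from : OutputsPreserved → NoEdgeFromOuterWire
          from preserved e (pt , w , ps) = proj₂ (preserved (s e , ps) (w , noOutC)) e refl
            where
            noOutC : ∀ e′ → ¬ TypedGraph.s (asGraph (complement H)) e′ ≡ (s e , ps)
            noOutC (e′ , pe′) eq = complement-edge-ends
              (subst (λ d → T (C.inE d)) (SG.wire-out (s e) w e′ e (cong proj₁ eq) refl) pe′) (inj₂ pt)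

proposition4p2 : (Σ𝑇 : Signature) → let open Graphs Σ𝑇 in
    (G : TypedGraph) → Finite G → IsStringGraph G →
    (H : Subgraph G) → IsStringGraph (asGraph H) →
    Open H ⇔ (IsStringGraph (asGraph (complement H)) × BoundaryCoherent (inclusion (complement H)))
proposition4p2 Σ𝑇 G _ sg H sh = mk⇔
  (λ (toWire , fromWire , noLeave) →
       fixedClosed⇒stringGraph (complement H) sg (to fixed noLeave)
     , to inputs toWire
     , to outputs fromWire)
  (λ (sc , preservesInputs , preservesOutputs) →
       from inputs preservesInputs
     , from outputs preservesOutputs
     , from fixed (stringGraph⇒fixedClosed (complement H) sg sc))
  where
  open Graphs Σ𝑇
  open StringSubgraphs Σ𝑇
  open Equivalence

  fixed : NoFixedEdgeLeaves H ⇔ FixedClosed (complement H)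
  fixed = noFixedEdgeLeaves⇔ H (stringGraph⇒fixedClosed H sg sh)

  inputs : NoEdgeToOuterWire H ⇔ InputsPreserved H
  inputs = noEdgeToOuterWire⇔ H sg

  outputs : NoEdgeFromOuterWire H ⇔ OutputsPreserved H
  outputs = noEdgeFromOuterWire⇔ H sg
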